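{- Let $O$ be a term and $Q,Q'$ bags with $x$ not free in $Q,Q'$. If $Q\to_o Q'$, then for every $L'\in O\langle Q'/x\rangle\{0/x\}$ there exists $L\in O\langle Q/x\rangle\{0/x\}$ such that $L\to_o L'$.
   Context: Resource calculus. Terms: $M ::= x \mid \lambda x.M \mid MP$; resources: $M$ (linear) or $M^{!}$ (reusable); bags are finite multisets of resources, written multiplicatively: $1$ empty, $[N]\cdot P$, $[N^{!}]\cdot P$. Sums are finite formal sums of terms (or bags), $0$ the empty sum; "$L\in\mathbb S$" means $L$ is a summand of $\mathbb S$. Constructors extend linearly to sums: $\lambda x.\sum_iM_i=\sum_i\lambda x.M_i$, $(\sum_iM_i)(\sum_jP_j)=\sum_{i,j}M_iP_j$, $[\sum_iM_i]\cdot\sum_jP_j=\sum_{i,j}[M_i]\cdot P_j$, while $[(\sum_{i=1}^kM_i)^{!}]\cdot\sum_jP_j=\sum_j[M_1^{!},\dots,M_k^{!}]\cdot P_j$. $A\{N/x\}$ is capture-free substitution. Linear substitution: $x\langle N/x\rangle=N$, $y\langle N/x\rangle=0$ ($y\ne x$), $(\lambda y.M)\langle N/x\rangle=\lambda y.M\langle N/x\rangle$, $(MP)\langle N/x\rangle=M\langle N/x\rangle P+MP\langle N/x\rangle$, $1\langle N/x\rangle=0$, $([M]\cdot P)\langle N/x\rangle=[M\langle N/x\rangle]\cdot P+[M]\cdot P\langle N/x\rangle$, $([M^{!}]\cdot P)\langle N/x\rangle=[M\langle N/x\rangle,M^{!}]\cdot P+[M^{!}]\cdot P\langle N/x\rangle$,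 extended bilinearly. $A\langle N^{!}/x\rangle:=A\{N+x/x\}$, and for a bag $A\langle[N_1^{(!)},\dots,N_n^{(!)}]/x\rangle:=A\langle N_1^{(!)}/x\rangle\cdots\langle N_n^{(!)}/x\rangle$. Giant step: $(\lambda x.M)P\to_g M\langle P/x\rangle\{0/x\}$ closed under one-hole contexts (of terms or bags); non-deterministic step $A\to_{nd}B$ iff $A\to_gB+\mathbb A$ for some sum $\mathbb A$. Outer non-deterministic reduction $\to_o$: the non-deterministic step applied to a redex not under the scope of any $(\cdot)^{!}$; this applies to terms and bags. -}

module Defs where

-- Resource calculus with de Bruijn indices (alpha-equivalence is built in).
-- Bags are represented by lists; the multiset quotient is recovered through
-- the equivalence _≈ₜ_ below (bag permutation, congruently).
-- Finite formal sums are represented by lists; "L ∈ 𝕊" is list membership.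

open import Data.Nat using (ℕ; zero; suc; pred; _≡ᵇ_; _<ᵇ_)
open import Data.Bool using (if_then_else_)
open import Data.List using (List; []; _∷_; _++_; map; concatMap; foldl)

mutual
  data Term : Set where
    var : ℕ → Term
    lam : Term → Term
    app : Term → Bag → Term

  data Resource : Set where
    lin  : Term → Resource
    bang : Term → Resource

  Bag : Set
  Bag = List Resource

-- Finite formal sums (0 = [], + = _++_)
Sum : Set → Set
Sum A = List A

mutual
  shiftₜ : ℕ → Term → Term
  shiftₜ c (var y) = if y <ᵇ c then var y else var (suc y)
  shiftₜ c (lam M) = lam (shiftₜ (suc c) M)
  shiftₜ c (app M P) = app (shiftₜ c M) (shiftᵇ c P)

  shiftʳ : ℕ → Resource → Resource
  shiftʳ c (lin M) = lin (shiftₜ c M)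
  shiftʳ c (bang M) = bang (shiftₜ c M)

  shiftᵇ : ℕ → Bag → Bag
  shiftᵇ c [] = []
  shiftᵇ c (r ∷ P) = shiftʳ c r ∷ shiftᵇ c P

-- lowerₜ c : decrement every index > c (used after the bound variable c
-- has been eliminated)
mutual
  lowerₜ : ℕ → Term → Term
  lowerₜ c (var y) = if c <ᵇ y then var (pred y) else var y
  lowerₜ c (lam M) = lam (lowerₜ (suc c) M)
  lowerₜ c (app M P) = app (lowerₜ c M) (lowerᵇ c P)

  lowerʳ : ℕ → Resource → Resource
  lowerʳ c (lin M) = lin (lowerₜ c M)
  lowerʳ c (bang M) = bang (lowerₜ c M)

  lowerᵇ : ℕ → Bag → Bag
  lowerᵇ c [] = []
  lowerᵇ c (r ∷ P) = lowerʳ c r ∷ lowerᵇ c P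

-- Capture-free substitution of a sum for a variable: A{𝕊/x}
-- (with [(Σᵢ Mᵢ)^!]·P = [M₁^!,…,M_k^!]·P)

mutual
  substₜ : Term → ℕ → Sum Term → Sum Term
  substₜ (var y) x S = if y ≡ᵇ x then S else var y ∷ []
  substₜ (lam M) x S = map lam (substₜ M (suc x) (map (shiftₜ 0) S))
  substₜ (app M P) x S =
    concatMap (λ m → map (app m) (substᵇ P x S)) (substₜ M x S)

  substᵇ : Bag → ℕ → Sum Term → Sum Bag
  substᵇ [] x S = [] ∷ []
  substᵇ (lin M ∷ P) x S =
    concatMap (λ m → map (lin m ∷_) (substᵇ P x S)) (substₜ M x S)
  substᵇ (bang M ∷ P) x S =
    map (λ p → map bang (substₜ M x S) ++ p) (substᵇ P x S)

zeroSubst : Sum Term → ℕ → Sum Term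
zeroSubst A x = concatMap (λ L → substₜ L x []) A

mutual
  linₜ : Term → ℕ → Term → Sum Term
  linₜ (var y) x N = if y ≡ᵇ x then N ∷ [] else []
  linₜ (lam M) x N = map lam (linₜ M (suc x) (shiftₜ 0 N))
  linₜ (app M P) x N =
    map (λ m → app m P) (linₜ M x N) ++ map (app M) (linᵇ P x N)

  linᵇ : Bag → ℕ → Term → Sum Bag
  linᵇ [] x N = []
  linᵇ (lin M ∷ P) x N =
    map (λ m → lin m ∷ P) (linₜ M x N) ++ map (lin M ∷_) (linᵇ P x N)
  linᵇ (bang M ∷ P) x N =
    map (λ m → lin m ∷ bang M ∷ P) (linₜ M x N) ++ map (bang M ∷_) (linᵇ P x N)

-- A⟨N/x⟩ and A⟨N^!/x⟩ := A{N + x/x}, extended linearly to a sum A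
resSubst : Sum Term → ℕ → Resource → Sum Term
resSubst A x (lin N)  = concatMap (λ L → linₜ L x N) A
resSubst A x (bang N) = concatMap (λ L → substₜ L x (N ∷ var x ∷ [])) A

bagSubst : Sum Term → ℕ → Bag → Sum Term
bagSubst A x Q = foldl (λ S R → resSubst S x R) A Q

bagSubst0 : Term → ℕ → Bag → Sum Term
bagSubst0 M x Q = zeroSubst (bagSubst (M ∷ []) x Q) x

-- Contractum of the redex (λ.M)P : M⟨P/0⟩{0/0}, then the indices of the
-- eliminated binder are lowered.  P is shifted since it moves under λ.
betaSum : Term → Bag → Sum Term
betaSum M P = map (lowerₜ 0) (bagSubst0 M 0 (shiftᵇ 0 P))

open import Data.List.Membership.Propositional using (_∈_)

mutual
  data _∈FVₜ_ : ℕ → Term → Set where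
    fv-var : ∀ {x} → x ∈FVₜ var x
    fv-lam : ∀ {x M} → suc x ∈FVₜ M → x ∈FVₜ lam M
    fv-appL : ∀ {x M P} → x ∈FVₜ M → x ∈FVₜ app M P
    fv-appR : ∀ {x M P} → x ∈FVᵇ P → x ∈FVₜ app M P

  data _∈FVᵇ_ : ℕ → Bag → Set where
    fv-lin  : ∀ {x M P} → x ∈FVₜ M → x ∈FVᵇ (lin M ∷ P)
    fv-bang : ∀ {x M P} → x ∈FVₜ M → x ∈FVᵇ (bang M ∷ P)
    fv-there : ∀ {x r P} → x ∈FVᵇ P → x ∈FVᵇ (r ∷ P)

-- Outer non-deterministic reduction (never under (·)^!)
-- L →o L' iff L' is a summand of C[M⟨P/x⟩{0/x}] for an outer context C.

mutual
  data _→oₜ_ : Term → Term → Set where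
    o-beta : ∀ {M P L} → L ∈ betaSum M P → app (lam M) P →oₜ L
    o-lam  : ∀ {M M'} → M →oₜ M' → lam M →oₜ lam M'
    o-appL : ∀ {M M' P} → M →oₜ M' → app M P →oₜ app M' P
    o-appR : ∀ {M P P'} → P →oᵇ P' → app M P →oₜ app M P'

  data _→oᵇ_ : Bag → Bag → Set where
    o-here  : ∀ {M M' P} → M →oₜ M' → (lin M ∷ P) →oᵇ (lin M' ∷ P)
    o-there : ∀ {r P P'} → P →oᵇ P' → (r ∷ P) →oᵇ (r ∷ P')

mutual
  data _≈ₜ_ : Term → Term → Set where
    ≈-var : ∀ {y} → var y ≈ₜ var y
    ≈-lam : ∀ {M M'} → M ≈ₜ M' → lam M ≈ₜ lam M'
    ≈-app : ∀ {M M' P P'} → M ≈ₜ M' → P ≈ᵇ P' → app M P ≈ₜ app M' P'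

  data _≈ʳ_ : Resource → Resource → Set where
    ≈-lin  : ∀ {M M'} → M ≈ₜ M' → lin M ≈ʳ lin M'
    ≈-bang : ∀ {M M'} → M ≈ₜ M' → bang M ≈ʳ bang M'

  data _≈ᵇ_ : Bag → Bag → Set where
    ≈-nil   : [] ≈ᵇ []
    ≈-cons  : ∀ {r r' P P'} → r ≈ʳ r' → P ≈ᵇ P' → (r ∷ P) ≈ᵇ (r' ∷ P')
    ≈-swap  : ∀ {r s P} → (r ∷ s ∷ P) ≈ᵇ (s ∷ r ∷ P)
    ≈-trans : ∀ {P P' P''} → P ≈ᵇ P' → P' ≈ᵇ P'' → P ≈ᵇ P''

module Submission where

-- The step Q →o Q' contracts a redex inside one linear resource N of Q, turning it into N'.
-- A summand of O⟨Q'/x⟩{0/x} therefore contains a copy of N' at a position where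
-- O⟨Q/x⟩{0/x} has a summand with the same copy of N; this position is outer, since linear
-- substitution only ever places the substituted term in a linear position.  Because x is not
-- free in N and N', every later substitution for x acts alike on both sides, so the relation
-- "equal up to one outer step inside a subterm not containing x" propagates summand by
-- summand.  Under a binder the copy of N is shifted, which is why shifting has to commute with
-- all substitutions and preserve outer reduction.

open import Defs
open import Data.Nat using (ℕ; zero; suc; pred; _≡ᵇ_; _<ᵇ_; _≤_; _<_; z≤n; s≤s; _≟_; _<?_)
open import Data.Nat.Properties
  using (≡ᵇ⇒≡; ≡⇒≡ᵇ; <ᵇ⇒<; <⇒<ᵇ; ≤⇒≯; ≮⇒≥; ≤∧≢⇒<; <-≤-trans; m≤n⇒m≤1+n; <⇒≤; n≤0⇒n≡0)
open import Data.Bool using (true; false)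
open import Data.Bool.Properties using (T-≡; ¬-not)
open import Data.List using (List; []; _∷_; _++_; map; concatMap)
open import Data.List.Properties using (map-++; map-cong; map-∘; concatMap-cong; concatMap-map; map-concatMap)
open import Data.List.Membership.Propositional using (_∈_; find; lose)
open import Data.List.Membership.Propositional.Properties
  using (∈-map⁺; ∈-map⁻; ∈-++⁺ˡ; ∈-++⁺ʳ; ∈-++⁻; ∈-concatMap⁺; ∈-concatMap⁻)
open import Data.List.Relation.Unary.Any using (here; there)
open import Data.Product using (Σ; ∃; ∃₂; _×_; _,_)
open import Data.Sum using (_⊎_; inj₁; inj₂)
open import Function using (_∘_; Equivalence)
open import Relation.Nullary using (¬_; yes; no; contradiction)
open import Relation.Binary.PropositionalEquality
open ≡-Reasoning

open Equivalence using (to; from)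

private
  variable
    A A′ B B′ C D : Set

≡ᵇ-refl : ∀ n → (n ≡ᵇ n) ≡ true
≡ᵇ-refl n = to T-≡ (≡⇒≡ᵇ n n refl)

≢⇒≡ᵇ≡false : ∀ {m n} → m ≢ n → (m ≡ᵇ n) ≡ false
≢⇒≡ᵇ≡false {m} {n} m≢n = ¬-not (m≢n ∘ ≡ᵇ⇒≡ m n ∘ from T-≡)

<⇒<ᵇ≡true : ∀ {m n} → m < n → (m <ᵇ n) ≡ true
<⇒<ᵇ≡true m<n = to T-≡ (<⇒<ᵇ m<n)

≥⇒<ᵇ≡false : ∀ {m n} → n ≤ m → (m <ᵇ n) ≡ false
≥⇒<ᵇ≡false {m} {n} n≤m = ¬-not (≤⇒≯ n≤m ∘ <ᵇ⇒< m n ∘ from T-≡)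

shiftₜ-var-< : ∀ {c y} → y < c → shiftₜ c (var y) ≡ var y
shiftₜ-var-< y<c rewrite <⇒<ᵇ≡true y<c = refl

shiftₜ-var-≥ : ∀ {c y} → c ≤ y → shiftₜ c (var y) ≡ var (suc y)
shiftₜ-var-≥ c≤y rewrite ≥⇒<ᵇ≡false c≤y = refl

lowerₜ-var-≤ : ∀ {d y} → y ≤ d → lowerₜ d (var y) ≡ var y
lowerₜ-var-≤ y≤d rewrite ≥⇒<ᵇ≡false y≤d = refl

lowerₜ-var-> : ∀ {d y} → d < y → lowerₜ d (var y) ≡ var (pred y)
lowerₜ-var-> d<y rewrite <⇒<ᵇ≡true d<y = refl

substₜ-var-≡ : ∀ x S → substₜ (var x) x S ≡ S
substₜ-var-≡ x S rewrite ≡ᵇ-refl x = refl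

substₜ-var-≢ : ∀ {x y} S → y ≢ x → substₜ (var y) x S ≡ var y ∷ []
substₜ-var-≢ S y≢x rewrite ≢⇒≡ᵇ≡false y≢x = refl

linₜ-var-≡ : ∀ x N → linₜ (var x) x N ≡ N ∷ []
linₜ-var-≡ x N rewrite ≡ᵇ-refl x = refl

linₜ-var-≢ : ∀ {x y} N → y ≢ x → linₜ (var y) x N ≡ []
linₜ-var-≢ N y≢x rewrite ≢⇒≡ᵇ≡false y≢x = refl

shiftₜ-var-≢ : ∀ {c x y} → x < c → y ≢ x → ∃ λ z → shiftₜ c (var y) ≡ var z × z ≢ x
shiftₜ-var-≢ {c} {x} {y} x<c y≢x with y <? c
... | yes y<c = y , shiftₜ-var-< y<c , y≢x
... | no y≮c = suc y , shiftₜ-var-≥ (≮⇒≥ y≮c) , λ { refl → ≤⇒≯ (≮⇒≥ y≮c) (<⇒≤ x<c) }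

-- Lists as finite sums

∈-concatMap-find : ∀ (f : A → List B) xs {y} → y ∈ concatMap f xs → ∃ λ a → a ∈ xs × y ∈ f a
∈-concatMap-find f xs m = find (∈-concatMap⁻ f m)

∈-concatMap-lose : ∀ (f : A → List B) {xs a y} → a ∈ xs → y ∈ f a → y ∈ concatMap f xs
∈-concatMap-lose f a∈xs y∈fa = ∈-concatMap⁺ f (lose a∈xs y∈fa)

∈-concatMap-map⁻ : ∀ (f : A → B → C) xs ys {z} → z ∈ concatMap (λ a → map (f a) ys) xs →
                   ∃₂ λ a b → a ∈ xs × b ∈ ys × z ≡ f a b
∈-concatMap-map⁻ f xs ys z∈ with ∈-concatMap-find (λ a → map (f a) ys) xs z∈
... | a , a∈xs , z∈fa with ∈-map⁻ (f a) z∈fa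
...   | b , b∈ys , refl = a , b , a∈xs , b∈ys , refl

∈-concatMap-map⁺ : ∀ (f : A → B → C) {xs ys a b} → a ∈ xs → b ∈ ys →
                   f a b ∈ concatMap (λ a → map (f a) ys) xs
∈-concatMap-map⁺ f {ys = ys} a∈xs b∈ys = ∈-concatMap-lose (λ a → map (f a) ys) a∈xs (∈-map⁺ (f _) b∈ys)

∈-map-++-map⁻ : ∀ (f : A → C) (g : B → C) xs ys {z} → z ∈ map f xs ++ map g ys →
                (∃ λ a → a ∈ xs × z ≡ f a) ⊎ (∃ λ b → b ∈ ys × z ≡ g b)
∈-map-++-map⁻ f g xs ys z∈ with ∈-++⁻ (map f xs) z∈
... | inj₁ z∈fxs = inj₁ (∈-map⁻ f z∈fxs)
... | inj₂ z∈gys = inj₂ (∈-map⁻ g z∈gys)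

map-∘-comm : ∀ {f : A → B} {g : B → D} {h : A → C} {k : C → D} →
             (∀ a → g (f a) ≡ k (h a)) → ∀ xs → map g (map f xs) ≡ map k (map h xs)
map-∘-comm eq xs = trans (sym (map-∘ xs)) (trans (map-cong eq xs) (map-∘ xs))

map-concatMap-comm : ∀ {h : B → D} {f : A → List B} {g : C → List D} {k : A → C} →
                     (∀ a → map h (f a) ≡ g (k a)) → ∀ xs → map h (concatMap f xs) ≡ concatMap g (map k xs)
map-concatMap-comm {h = h} {f} {g} {k} eq xs =
  trans (map-concatMap h f xs) (trans (concatMap-cong eq xs) (sym (concatMap-map g k xs)))

map-++-comm : ∀ {h : C → D} {f : A → C} {g : B → C} {f′ : A′ → D} {g′ : B′ → D}
              {hA : A → A′} {hB : B → B′} → (∀ a → h (f a) ≡ f′ (hA a)) → (∀ b → h (g b) ≡ g′ (hB b)) →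
              ∀ xs ys → map h (map f xs ++ map g ys) ≡ map f′ (map hA xs) ++ map g′ (map hB ys)
map-++-comm {h = h} {f} {g} eqf eqg xs ys =
  trans (map-++ h (map f xs) (map g ys)) (cong₂ _++_ (map-∘-comm eqf xs) (map-∘-comm eqg ys))

-- Shifting

shiftₜ-comm-var : ∀ {c d} → d ≤ c → ∀ y → shiftₜ (suc c) (shiftₜ d (var y)) ≡ shiftₜ d (shiftₜ c (var y))
shiftₜ-comm-var {c} {d} d≤c y with y <? d | y <? c
... | yes y<d | _
  rewrite shiftₜ-var-< (<-≤-trans y<d d≤c) | shiftₜ-var-< y<d
        | shiftₜ-var-< {suc c} (m≤n⇒m≤1+n (<-≤-trans y<d d≤c)) = refl
... | no y≮d | yes y<c
  rewrite shiftₜ-var-< y<c | shiftₜ-var-≥ (≮⇒≥ y≮d) | shiftₜ-var-< {suc c} (s≤s y<c) = refl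
... | no y≮d | no y≮c
  rewrite shiftₜ-var-≥ (≮⇒≥ y≮c) | shiftₜ-var-≥ (≮⇒≥ y≮d)
        | shiftₜ-var-≥ {suc c} (s≤s (≮⇒≥ y≮c)) | shiftₜ-var-≥ (m≤n⇒m≤1+n (≮⇒≥ y≮d)) = refl

mutual
  shiftₜ-comm : ∀ {c d} → d ≤ c → ∀ T → shiftₜ (suc c) (shiftₜ d T) ≡ shiftₜ d (shiftₜ c T)
  shiftₜ-comm d≤c (var y)   = shiftₜ-comm-var d≤c y
  shiftₜ-comm d≤c (lam M)   = cong lam (shiftₜ-comm (s≤s d≤c) M)
  shiftₜ-comm d≤c (app M P) = cong₂ app (shiftₜ-comm d≤c M) (shiftᵇ-comm d≤c P)

  shiftᵇ-comm : ∀ {c d} → d ≤ c → ∀ P → shiftᵇ (suc c) (shiftᵇ d P) ≡ shiftᵇ d (shiftᵇ c P)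
  shiftᵇ-comm d≤c []           = refl
  shiftᵇ-comm d≤c (lin M ∷ P)  = cong₂ _∷_ (cong lin (shiftₜ-comm d≤c M)) (shiftᵇ-comm d≤c P)
  shiftᵇ-comm d≤c (bang M ∷ P) = cong₂ _∷_ (cong bang (shiftₜ-comm d≤c M)) (shiftᵇ-comm d≤c P)

shiftₜ-lowerₜ-var : ∀ {c d} → d ≤ c → ∀ y → d ≢ y →
                    shiftₜ c (lowerₜ d (var y)) ≡ lowerₜ d (shiftₜ (suc c) (var y))
shiftₜ-lowerₜ-var {c} {d} d≤c y d≢y with y <? d
... | yes y<d
  rewrite lowerₜ-var-≤ (<⇒≤ y<d) | shiftₜ-var-< (<-≤-trans y<d d≤c)
        | shiftₜ-var-< {suc c} (m≤n⇒m≤1+n (<-≤-trans y<d d≤c)) | lowerₜ-var-≤ (<⇒≤ y<d) = refl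
shiftₜ-lowerₜ-var {c} {d} d≤c zero d≢0 | no 0≮d = contradiction (n≤0⇒n≡0 (≮⇒≥ 0≮d)) d≢0
shiftₜ-lowerₜ-var {c} {d} d≤c (suc y) d≢1+y | no 1+y≮d with ≤∧≢⇒< (≮⇒≥ 1+y≮d) d≢1+y | y <? c
... | d<1+y | yes y<c
  rewrite lowerₜ-var-> d<1+y | shiftₜ-var-< y<c | shiftₜ-var-< {suc c} (s≤s y<c) | lowerₜ-var-> d<1+y = refl
... | d<1+y | no y≮c
  rewrite lowerₜ-var-> d<1+y | shiftₜ-var-≥ (≮⇒≥ y≮c) | shiftₜ-var-≥ {suc c} (s≤s (≮⇒≥ y≮c))
        | lowerₜ-var-> (m≤n⇒m≤1+n d<1+y) = refl

mutual
  shiftₜ-lowerₜ : ∀ {c d} → d ≤ c → ∀ T → ¬ d ∈FVₜ T → shiftₜ c (lowerₜ d T) ≡ lowerₜ d (shiftₜ (suc c) T)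
  shiftₜ-lowerₜ d≤c (var y) d∉ = shiftₜ-lowerₜ-var d≤c y (λ { refl → d∉ fv-var })
  shiftₜ-lowerₜ d≤c (lam M) d∉ = cong lam (shiftₜ-lowerₜ (s≤s d≤c) M (d∉ ∘ fv-lam))
  shiftₜ-lowerₜ d≤c (app M P) d∉ =
    cong₂ app (shiftₜ-lowerₜ d≤c M (d∉ ∘ fv-appL)) (shiftᵇ-lowerᵇ d≤c P (d∉ ∘ fv-appR))

  shiftᵇ-lowerᵇ : ∀ {c d} → d ≤ c → ∀ P → ¬ d ∈FVᵇ P → shiftᵇ c (lowerᵇ d P) ≡ lowerᵇ d (shiftᵇ (suc c) P)
  shiftᵇ-lowerᵇ d≤c [] d∉ = refl
  shiftᵇ-lowerᵇ d≤c (lin M ∷ P) d∉ =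
    cong₂ _∷_ (cong lin (shiftₜ-lowerₜ d≤c M (d∉ ∘ fv-lin))) (shiftᵇ-lowerᵇ d≤c P (d∉ ∘ fv-there))
  shiftᵇ-lowerᵇ d≤c (bang M ∷ P) d∉ =
    cong₂ _∷_ (cong bang (shiftₜ-lowerₜ d≤c M (d∉ ∘ fv-bang))) (shiftᵇ-lowerᵇ d≤c P (d∉ ∘ fv-there))

mutual
  ∈FVₜ-shiftₜ⁻ : ∀ {c x} → c ≤ x → ∀ M → suc x ∈FVₜ shiftₜ c M → x ∈FVₜ M
  ∈FVₜ-shiftₜ⁻ {c} c≤x (var y) x∈ with y <? c
  ... | yes y<c with subst (_ ∈FVₜ_) (shiftₜ-var-< y<c) x∈
  ...   | fv-var = contradiction (<⇒≤ y<c) (≤⇒≯ c≤x)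
  ∈FVₜ-shiftₜ⁻ {c} c≤x (var y) x∈ | no y≮c with subst (_ ∈FVₜ_) (shiftₜ-var-≥ (≮⇒≥ y≮c)) x∈
  ...   | fv-var = fv-var
  ∈FVₜ-shiftₜ⁻ c≤x (lam M) (fv-lam x∈) = fv-lam (∈FVₜ-shiftₜ⁻ (s≤s c≤x) M x∈)
  ∈FVₜ-shiftₜ⁻ c≤x (app M P) (fv-appL x∈) = fv-appL (∈FVₜ-shiftₜ⁻ c≤x M x∈)
  ∈FVₜ-shiftₜ⁻ c≤x (app M P) (fv-appR x∈) = fv-appR (∈FVᵇ-shiftᵇ⁻ c≤x P x∈)

  ∈FVᵇ-shiftᵇ⁻ : ∀ {c x} → c ≤ x → ∀ P → suc x ∈FVᵇ shiftᵇ c P → x ∈FVᵇ P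
  ∈FVᵇ-shiftᵇ⁻ c≤x (lin M ∷ P)  (fv-lin x∈)   = fv-lin (∈FVₜ-shiftₜ⁻ c≤x M x∈)
  ∈FVᵇ-shiftᵇ⁻ c≤x (bang M ∷ P) (fv-bang x∈)  = fv-bang (∈FVₜ-shiftₜ⁻ c≤x M x∈)
  ∈FVᵇ-shiftᵇ⁻ c≤x (r ∷ P)      (fv-there x∈) = fv-there (∈FVᵇ-shiftᵇ⁻ c≤x P x∈)

∈FVᵇ-bangs-++⁻ : ∀ ts {x P} → x ∈FVᵇ (map bang ts ++ P) → (∃ λ t → t ∈ ts × x ∈FVₜ t) ⊎ x ∈FVᵇ P
∈FVᵇ-bangs-++⁻ []       x∈ = inj₂ x∈
∈FVᵇ-bangs-++⁻ (t ∷ ts) (fv-bang x∈) = inj₁ (t , here refl , x∈)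
∈FVᵇ-bangs-++⁻ (t ∷ ts) (fv-there x∈) with ∈FVᵇ-bangs-++⁻ ts x∈
... | inj₁ (t' , t'∈ , x∈t') = inj₁ (t' , there t'∈ , x∈t')
... | inj₂ x∈P = inj₂ x∈P

mutual
  ∉FV-substₜ[] : ∀ U x {T} → T ∈ substₜ U x [] → ¬ x ∈FVₜ T
  ∉FV-substₜ[] (var y) x T∈ x∈ with y ≟ x
  ... | yes refl with subst (_ ∈_) (substₜ-var-≡ x []) T∈
  ...   | ()
  ∉FV-substₜ[] (var y) x T∈ x∈ | no y≢x with subst (_ ∈_) (substₜ-var-≢ [] y≢x) T∈ | x∈
  ...   | here refl | fv-var = y≢x refl
  ∉FV-substₜ[] (lam M) x T∈ x∈ with ∈-map⁻ lam T∈ | x∈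
  ... | T₀ , T₀∈ , refl | fv-lam x∈T₀ = ∉FV-substₜ[] M (suc x) T₀∈ x∈T₀
  ∉FV-substₜ[] (app M P) x T∈ x∈ with ∈-concatMap-map⁻ app (substₜ M x []) (substᵇ P x []) T∈ | x∈
  ... | m , p , m∈ , p∈ , refl | fv-appL x∈m = ∉FV-substₜ[] M x m∈ x∈m
  ... | m , p , m∈ , p∈ , refl | fv-appR x∈p = ∉FV-substᵇ[] P x p∈ x∈p

  ∉FV-substᵇ[] : ∀ P x {q} → q ∈ substᵇ P x [] → ¬ x ∈FVᵇ q
  ∉FV-substᵇ[] [] x (here refl) ()
  ∉FV-substᵇ[] (lin M ∷ P) x q∈ x∈
    with ∈-concatMap-map⁻ (λ m p → lin m ∷ p) (substₜ M x []) (substᵇ P x []) q∈ | x∈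
  ... | m , p , m∈ , p∈ , refl | fv-lin x∈m   = ∉FV-substₜ[] M x m∈ x∈m
  ... | m , p , m∈ , p∈ , refl | fv-there x∈p = ∉FV-substᵇ[] P x p∈ x∈p
  ∉FV-substᵇ[] (bang M ∷ P) x q∈ x∈ with ∈-map⁻ (map bang (substₜ M x []) ++_) q∈
  ... | p , p∈ , refl with ∈FVᵇ-bangs-++⁻ (substₜ M x []) x∈
  ...   | inj₁ (t , t∈ , x∈t) = ∉FV-substₜ[] M x t∈ x∈t
  ...   | inj₂ x∈p = ∉FV-substᵇ[] P x p∈ x∈p

mutual
  substₜ-shift : ∀ {c x} → x < c → ∀ T S →
                 map (shiftₜ c) (substₜ T x S) ≡ substₜ (shiftₜ c T) x (map (shiftₜ c) S)
  substₜ-shift {c} {x} x<c (var y) S with y ≟ x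
  ... | yes refl rewrite shiftₜ-var-< x<c | substₜ-var-≡ x S | substₜ-var-≡ x (map (shiftₜ c) S) = refl
  ... | no y≢x with shiftₜ-var-≢ x<c y≢x
  ...   | z , ≡var-z , z≢x
          rewrite substₜ-var-≢ S y≢x | ≡var-z | substₜ-var-≢ (map (shiftₜ c) S) z≢x = refl
  substₜ-shift {c} {x} x<c (lam M) S = begin
    map (shiftₜ c) (map lam (substₜ M (suc x) (map (shiftₜ 0) S)))
      ≡⟨ map-∘-comm (λ _ → refl) _ ⟩
    map lam (map (shiftₜ (suc c)) (substₜ M (suc x) (map (shiftₜ 0) S)))
      ≡⟨ cong (map lam) (substₜ-shift (s≤s x<c) M _) ⟩
    map lam (substₜ (shiftₜ (suc c) M) (suc x) (map (shiftₜ (suc c)) (map (shiftₜ 0) S)))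
      ≡⟨ cong (map lam ∘ substₜ (shiftₜ (suc c) M) (suc x)) (map-∘-comm (shiftₜ-comm z≤n) S) ⟩
    map lam (substₜ (shiftₜ (suc c) M) (suc x) (map (shiftₜ 0) (map (shiftₜ c) S))) ∎
  substₜ-shift {c} {x} x<c (app M P) S = begin
    map (shiftₜ c) (concatMap (λ m → map (app m) (substᵇ P x S)) (substₜ M x S))
      ≡⟨ map-concatMap-comm (λ _ → map-∘-comm (λ _ → refl) (substᵇ P x S)) (substₜ M x S) ⟩
    concatMap (λ m → map (app m) (map (shiftᵇ c) (substᵇ P x S))) (map (shiftₜ c) (substₜ M x S))
      ≡⟨ cong₂ (λ ms ps → concatMap (λ m → map (app m) ps) ms) (substₜ-shift x<c M S) (substᵇ-shift x<c P S) ⟩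
    substₜ (shiftₜ c (app M P)) x (map (shiftₜ c) S) ∎

  substᵇ-shift : ∀ {c x} → x < c → ∀ P S →
                 map (shiftᵇ c) (substᵇ P x S) ≡ substᵇ (shiftᵇ c P) x (map (shiftₜ c) S)
  substᵇ-shift x<c [] S = refl
  substᵇ-shift {c} {x} x<c (lin M ∷ P) S = begin
    map (shiftᵇ c) (concatMap (λ m → map (lin m ∷_) (substᵇ P x S)) (substₜ M x S))
      ≡⟨ map-concatMap-comm (λ _ → map-∘-comm (λ _ → refl) (substᵇ P x S)) (substₜ M x S) ⟩
    concatMap (λ m → map (lin m ∷_) (map (shiftᵇ c) (substᵇ P x S))) (map (shiftₜ c) (substₜ M x S))
      ≡⟨ cong₂ (λ ms ps → concatMap (λ m → map (lin m ∷_) ps) ms) (substₜ-shift x<c M S) (substᵇ-shift x<c P S) ⟩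
    substᵇ (shiftᵇ c (lin M ∷ P)) x (map (shiftₜ c) S) ∎
  substᵇ-shift {c} {x} x<c (bang M ∷ P) S = begin
    map (shiftᵇ c) (map (map bang (substₜ M x S) ++_) (substᵇ P x S))
      ≡⟨ map-∘-comm (λ p → shiftᵇ-bangs-++ (substₜ M x S) p) _ ⟩
    map (map bang (map (shiftₜ c) (substₜ M x S)) ++_) (map (shiftᵇ c) (substᵇ P x S))
      ≡⟨ cong₂ (λ ms ps → map (map bang ms ++_) ps) (substₜ-shift x<c M S) (substᵇ-shift x<c P S) ⟩
    substᵇ (shiftᵇ c (bang M ∷ P)) x (map (shiftₜ c) S) ∎
    where
    shiftᵇ-bangs-++ : ∀ ts p → shiftᵇ c (map bang ts ++ p) ≡ map bang (map (shiftₜ c) ts) ++ shiftᵇ c p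
    shiftᵇ-bangs-++ []       p = refl
    shiftᵇ-bangs-++ (t ∷ ts) p = cong (bang (shiftₜ c t) ∷_) (shiftᵇ-bangs-++ ts p)

mutual
  linₜ-shift : ∀ {c x} → x < c → ∀ T N → map (shiftₜ c) (linₜ T x N) ≡ linₜ (shiftₜ c T) x (shiftₜ c N)
  linₜ-shift {c} {x} x<c (var y) N with y ≟ x
  ... | yes refl rewrite shiftₜ-var-< x<c | linₜ-var-≡ x N | linₜ-var-≡ x (shiftₜ c N) = refl
  ... | no y≢x with shiftₜ-var-≢ x<c y≢x
  ...   | z , ≡var-z , z≢x rewrite linₜ-var-≢ N y≢x | ≡var-z | linₜ-var-≢ (shiftₜ c N) z≢x = refl
  linₜ-shift {c} {x} x<c (lam M) N = begin
    map (shiftₜ c) (map lam (linₜ M (suc x) (shiftₜ 0 N)))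
      ≡⟨ map-∘-comm (λ _ → refl) _ ⟩
    map lam (map (shiftₜ (suc c)) (linₜ M (suc x) (shiftₜ 0 N)))
      ≡⟨ cong (map lam) (linₜ-shift (s≤s x<c) M _) ⟩
    map lam (linₜ (shiftₜ (suc c) M) (suc x) (shiftₜ (suc c) (shiftₜ 0 N)))
      ≡⟨ cong (map lam ∘ linₜ (shiftₜ (suc c) M) (suc x)) (shiftₜ-comm z≤n N) ⟩
    map lam (linₜ (shiftₜ (suc c) M) (suc x) (shiftₜ 0 (shiftₜ c N))) ∎
  linₜ-shift {c} {x} x<c (app M P) N = begin
    map (shiftₜ c) (map (λ m → app m P) (linₜ M x N) ++ map (app M) (linᵇ P x N))
      ≡⟨ map-++-comm (λ _ → refl) (λ _ → refl) (linₜ M x N) (linᵇ P x N) ⟩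
    map (λ m → app m (shiftᵇ c P)) (map (shiftₜ c) (linₜ M x N))
      ++ map (app (shiftₜ c M)) (map (shiftᵇ c) (linᵇ P x N))
      ≡⟨ cong₂ (λ ms ps → map (λ m → app m (shiftᵇ c P)) ms ++ map (app (shiftₜ c M)) ps)
               (linₜ-shift x<c M N) (linᵇ-shift x<c P N) ⟩
    linₜ (shiftₜ c (app M P)) x (shiftₜ c N) ∎

  linᵇ-shift : ∀ {c x} → x < c → ∀ P N → map (shiftᵇ c) (linᵇ P x N) ≡ linᵇ (shiftᵇ c P) x (shiftₜ c N)
  linᵇ-shift x<c [] N = refl
  linᵇ-shift {c} {x} x<c (lin M ∷ P) N = begin
    map (shiftᵇ c) (map (λ m → lin m ∷ P) (linₜ M x N) ++ map (lin M ∷_) (linᵇ P x N))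
      ≡⟨ map-++-comm (λ _ → refl) (λ _ → refl) (linₜ M x N) (linᵇ P x N) ⟩
    map (λ m → lin m ∷ shiftᵇ c P) (map (shiftₜ c) (linₜ M x N))
      ++ map (lin (shiftₜ c M) ∷_) (map (shiftᵇ c) (linᵇ P x N))
      ≡⟨ cong₂ (λ ms ps → map (λ m → lin m ∷ shiftᵇ c P) ms ++ map (lin (shiftₜ c M) ∷_) ps)
               (linₜ-shift x<c M N) (linᵇ-shift x<c P N) ⟩
    linᵇ (shiftᵇ c (lin M ∷ P)) x (shiftₜ c N) ∎
  linᵇ-shift {c} {x} x<c (bang M ∷ P) N = begin
    map (shiftᵇ c) (map (λ m → lin m ∷ bang M ∷ P) (linₜ M x N) ++ map (bang M ∷_) (linᵇ P x N))
      ≡⟨ map-++-comm (λ _ → refl) (λ _ → refl) (linₜ M x N) (linᵇ P x N) ⟩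
    map (λ m → lin m ∷ bang (shiftₜ c M) ∷ shiftᵇ c P) (map (shiftₜ c) (linₜ M x N))
      ++ map (bang (shiftₜ c M) ∷_) (map (shiftᵇ c) (linᵇ P x N))
      ≡⟨ cong₂ (λ ms ps → map (λ m → lin m ∷ bang (shiftₜ c M) ∷ shiftᵇ c P) ms
                            ++ map (bang (shiftₜ c M) ∷_) ps)
               (linₜ-shift x<c M N) (linᵇ-shift x<c P N) ⟩
    linᵇ (shiftᵇ c (bang M ∷ P)) x (shiftₜ c N) ∎

resSubst-shift : ∀ {c x} → x < c → ∀ 𝔸 R →
                 map (shiftₜ c) (resSubst 𝔸 x R) ≡ resSubst (map (shiftₜ c) 𝔸) x (shiftʳ c R)
resSubst-shift x<c 𝔸 (lin N) = map-concatMap-comm (λ L → linₜ-shift x<c L N) 𝔸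
resSubst-shift {c} {x} x<c 𝔸 (bang N) = map-concatMap-comm shift-[N,x] 𝔸
  where
  shift-[N,x] : ∀ L → map (shiftₜ c) (substₜ L x (N ∷ var x ∷ []))
                    ≡ substₜ (shiftₜ c L) x (shiftₜ c N ∷ var x ∷ [])
  shift-[N,x] L = trans (substₜ-shift x<c L _)
                        (cong (λ v → substₜ (shiftₜ c L) x (shiftₜ c N ∷ v ∷ [])) (shiftₜ-var-< x<c))

bagSubst-shift : ∀ {c x} → x < c → ∀ Q 𝔸 →
                 map (shiftₜ c) (bagSubst 𝔸 x Q) ≡ bagSubst (map (shiftₜ c) 𝔸) x (shiftᵇ c Q)
bagSubst-shift x<c [] 𝔸 = refl
bagSubst-shift {c} {x} x<c (R ∷ Q) 𝔸 =
  trans (bagSubst-shift x<c Q (resSubst 𝔸 x R)) (cong (λ 𝔹 → bagSubst 𝔹 x (shiftᵇ c Q)) (resSubst-shift x<c 𝔸 R))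

zeroSubst-shift : ∀ {c x} → x < c → ∀ 𝔸 → map (shiftₜ c) (zeroSubst 𝔸 x) ≡ zeroSubst (map (shiftₜ c) 𝔸) x
zeroSubst-shift x<c = map-concatMap-comm (λ L → substₜ-shift x<c L [])

bagSubst0-shift : ∀ {c x} → x < c → ∀ M Q →
                  map (shiftₜ c) (bagSubst0 M x Q) ≡ bagSubst0 (shiftₜ c M) x (shiftᵇ c Q)
bagSubst0-shift {x = x} x<c M Q =
  trans (zeroSubst-shift x<c (bagSubst (M ∷ []) x Q)) (cong (λ 𝔹 → zeroSubst 𝔹 x) (bagSubst-shift x<c Q (M ∷ [])))

∉FV-bagSubst0 : ∀ M x Q {T} → T ∈ bagSubst0 M x Q → ¬ x ∈FVₜ T
∉FV-bagSubst0 M x Q T∈ with ∈-concatMap-find (λ L → substₜ L x []) (bagSubst (M ∷ []) x Q) T∈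
... | U , _ , T∈U = ∉FV-substₜ[] U x T∈U

betaSum-shift : ∀ c M P {L} → L ∈ betaSum M P → shiftₜ c L ∈ betaSum (shiftₜ (suc c) M) (shiftᵇ c P)
betaSum-shift c M P L∈ with ∈-map⁻ (lowerₜ 0) L∈
... | T , T∈ , refl =
  subst (_∈ betaSum (shiftₜ (suc c) M) (shiftᵇ c P))
        (sym (shiftₜ-lowerₜ z≤n T (∉FV-bagSubst0 M 0 (shiftᵇ 0 P) T∈)))
        (∈-map⁺ (lowerₜ 0) (subst (shiftₜ (suc c) T ∈_) shift-contractum (∈-map⁺ (shiftₜ (suc c)) T∈)))
  where
  shift-contractum : map (shiftₜ (suc c)) (bagSubst0 M 0 (shiftᵇ 0 P))
                   ≡ bagSubst0 (shiftₜ (suc c) M) 0 (shiftᵇ 0 (shiftᵇ c P))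
  shift-contractum = trans (bagSubst0-shift (s≤s z≤n) M (shiftᵇ 0 P))
                           (cong (bagSubst0 (shiftₜ (suc c) M) 0) (shiftᵇ-comm z≤n P))

mutual
  →oₜ-shift : ∀ c {M M'} → M →oₜ M' → shiftₜ c M →oₜ shiftₜ c M'
  →oₜ-shift c (o-beta {M} {P} L∈) = o-beta (betaSum-shift c M P L∈)
  →oₜ-shift c (o-lam M→M')        = o-lam (→oₜ-shift (suc c) M→M')
  →oₜ-shift c (o-appL M→M')       = o-appL (→oₜ-shift c M→M')
  →oₜ-shift c (o-appR P→P')       = o-appR (→oᵇ-shift c P→P')

  →oᵇ-shift : ∀ c {P P'} → P →oᵇ P' → shiftᵇ c P →oᵇ shiftᵇ c P'
  →oᵇ-shift c (o-here M→M')  = o-here (→oₜ-shift c M→M')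
  →oᵇ-shift c (o-there P→P') = o-there (→oᵇ-shift c P→P')

-- Substituting for an absent variable

mutual
  linₜ-fresh : ∀ {x} T N → ¬ x ∈FVₜ T → linₜ T x N ≡ []
  linₜ-fresh {x} (var y) N x∉ = linₜ-var-≢ {x} {y} N (λ { refl → x∉ fv-var })
  linₜ-fresh (lam M) N x∉ = cong (map lam) (linₜ-fresh M (shiftₜ 0 N) (x∉ ∘ fv-lam))
  linₜ-fresh (app M P) N x∉ =
    cong₂ (λ ms ps → map (λ m → app m P) ms ++ map (app M) ps)
          (linₜ-fresh M N (x∉ ∘ fv-appL)) (linᵇ-fresh P N (x∉ ∘ fv-appR))

  linᵇ-fresh : ∀ {x} P N → ¬ x ∈FVᵇ P → linᵇ P x N ≡ []
  linᵇ-fresh [] N x∉ = refl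
  linᵇ-fresh (lin M ∷ P) N x∉ =
    cong₂ (λ ms ps → map (λ m → lin m ∷ P) ms ++ map (lin M ∷_) ps)
          (linₜ-fresh M N (x∉ ∘ fv-lin)) (linᵇ-fresh P N (x∉ ∘ fv-there))
  linᵇ-fresh (bang M ∷ P) N x∉ =
    cong₂ (λ ms ps → map (λ m → lin m ∷ bang M ∷ P) ms ++ map (bang M ∷_) ps)
          (linₜ-fresh M N (x∉ ∘ fv-bang)) (linᵇ-fresh P N (x∉ ∘ fv-there))

mutual
  substₜ-fresh : ∀ {x} T S → ¬ x ∈FVₜ T → substₜ T x S ≡ T ∷ []
  substₜ-fresh {x} (var y) S x∉ = substₜ-var-≢ {x} {y} S (λ { refl → x∉ fv-var })
  substₜ-fresh (lam M) S x∉ = cong (map lam) (substₜ-fresh M (map (shiftₜ 0) S) (x∉ ∘ fv-lam))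
  substₜ-fresh (app M P) S x∉ =
    cong₂ (λ ms ps → concatMap (λ m → map (app m) ps) ms)
          (substₜ-fresh M S (x∉ ∘ fv-appL)) (substᵇ-fresh P S (x∉ ∘ fv-appR))

  substᵇ-fresh : ∀ {x} P S → ¬ x ∈FVᵇ P → substᵇ P x S ≡ P ∷ []
  substᵇ-fresh [] S x∉ = refl
  substᵇ-fresh (lin M ∷ P) S x∉ =
    cong₂ (λ ms ps → concatMap (λ m → map (lin m ∷_) ps) ms)
          (substₜ-fresh M S (x∉ ∘ fv-lin)) (substᵇ-fresh P S (x∉ ∘ fv-there))
  substᵇ-fresh (bang M ∷ P) S x∉ =
    cong₂ (λ ms ps → map (map bang ms ++_) ps)
          (substₜ-fresh M S (x∉ ∘ fv-bang)) (substᵇ-fresh P S (x∉ ∘ fv-there))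

infix 4 _⊢_⇝ₜ_ _⊢_⇝ᵇ_

-- The step takes place inside a subterm not containing x, so substitutions for x leave it intact.
mutual
  data _⊢_⇝ₜ_ : ℕ → Term → Term → Set where
    ⇝-hole : ∀ {x S S'} → ¬ x ∈FVₜ S → ¬ x ∈FVₜ S' → S →oₜ S' → x ⊢ S ⇝ₜ S'
    ⇝-lam  : ∀ {x M M'} → suc x ⊢ M ⇝ₜ M' → x ⊢ lam M ⇝ₜ lam M'
    ⇝-appL : ∀ {x M M' P} → x ⊢ M ⇝ₜ M' → x ⊢ app M P ⇝ₜ app M' P
    ⇝-appR : ∀ {x M P P'} → x ⊢ P ⇝ᵇ P' → x ⊢ app M P ⇝ₜ app M P'

  data _⊢_⇝ᵇ_ : ℕ → Bag → Bag → Set where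
    ⇝-here  : ∀ {x M M' P} → x ⊢ M ⇝ₜ M' → x ⊢ lin M ∷ P ⇝ᵇ lin M' ∷ P
    ⇝-there : ∀ {x r P P'} → x ⊢ P ⇝ᵇ P' → x ⊢ r ∷ P ⇝ᵇ r ∷ P'

mutual
  ⇝ₜ⇒→oₜ : ∀ {x T T'} → x ⊢ T ⇝ₜ T' → T →oₜ T'
  ⇝ₜ⇒→oₜ (⇝-hole _ _ S→S') = S→S'
  ⇝ₜ⇒→oₜ (⇝-lam M⇝M')      = o-lam (⇝ₜ⇒→oₜ M⇝M')
  ⇝ₜ⇒→oₜ (⇝-appL M⇝M')     = o-appL (⇝ₜ⇒→oₜ M⇝M')
  ⇝ₜ⇒→oₜ (⇝-appR P⇝P')     = o-appR (⇝ᵇ⇒→oᵇ P⇝P')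

  ⇝ᵇ⇒→oᵇ : ∀ {x P P'} → x ⊢ P ⇝ᵇ P' → P →oᵇ P'
  ⇝ᵇ⇒→oᵇ (⇝-here M⇝M')  = o-here (⇝ₜ⇒→oₜ M⇝M')
  ⇝ᵇ⇒→oᵇ (⇝-there P⇝P') = o-there (⇝ᵇ⇒→oᵇ P⇝P')

Covers : (A → B → Set) → Sum A → Sum B → Set
Covers R 𝔸 𝔹 = ∀ {b} → b ∈ 𝔹 → ∃ λ a → a ∈ 𝔸 × R a b

Covers-refl : ∀ 𝔸 → Covers (_≡_ {A = A}) 𝔸 𝔸
Covers-refl 𝔸 a∈ = _ , a∈ , refl

Covers-concatMap : ∀ {R : A → B → Set} {R′ : C → D → Set} (f : A → List C) (g : B → List D) →
                   (∀ {a b} → R a b → Covers R′ (f a) (g b)) →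
                   ∀ {𝔸 𝔹} → Covers R 𝔸 𝔹 → Covers R′ (concatMap f 𝔸) (concatMap g 𝔹)
Covers-concatMap f g cover-f-g {𝔸} {𝔹} covers d∈ with ∈-concatMap-find g 𝔹 d∈
... | b , b∈ , d∈gb with covers b∈
...   | a , a∈ , Rab with cover-f-g Rab d∈gb
...     | c , c∈fa , R′cd = c , ∈-concatMap-lose f a∈ c∈fa , R′cd

mutual
  linₜ-→oₜ-covers : ∀ {x N N'} → N →oₜ N' → ¬ x ∈FVₜ N → ¬ x ∈FVₜ N' →
                    ∀ L → Covers (x ⊢_⇝ₜ_) (linₜ L x N) (linₜ L x N')
  linₜ-→oₜ-covers {x} {N} {N'} N→N' x∉N x∉N' (var y) T'∈ with y ≟ x
  ... | no y≢x = contradiction (subst (_ ∈_) (linₜ-var-≢ N' y≢x) T'∈) λ ()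
  ... | yes refl with subst (_ ∈_) (linₜ-var-≡ x N') T'∈
  ...   | here refl = N , subst (N ∈_) (sym (linₜ-var-≡ x N)) (here refl) , ⇝-hole x∉N x∉N' N→N'
  linₜ-→oₜ-covers {x} {N} {N'} N→N' x∉N x∉N' (lam M) T'∈ with ∈-map⁻ lam T'∈
  ... | M' , M'∈ , refl with linₜ-→oₜ-covers (→oₜ-shift 0 N→N') (x∉N ∘ ∈FVₜ-shiftₜ⁻ z≤n N)
                                               (x∉N' ∘ ∈FVₜ-shiftₜ⁻ z≤n N') M M'∈
  ...   | M₀ , M₀∈ , M₀⇝M' = lam M₀ , ∈-map⁺ lam M₀∈ , ⇝-lam M₀⇝M'
  linₜ-→oₜ-covers {x} {N} {N'} N→N' x∉N x∉N' (app M P) T'∈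
    with ∈-map-++-map⁻ (λ m → app m P) (app M) (linₜ M x N') (linᵇ P x N') T'∈
  ... | inj₁ (m' , m'∈ , refl) with linₜ-→oₜ-covers N→N' x∉N x∉N' M m'∈
  ...   | m , m∈ , m⇝m' = app m P , ∈-++⁺ˡ (∈-map⁺ (λ m → app m P) m∈) , ⇝-appL m⇝m'
  linₜ-→oₜ-covers {x} {N} {N'} N→N' x∉N x∉N' (app M P) T'∈ | inj₂ (p' , p'∈ , refl)
    with linᵇ-→oₜ-covers N→N' x∉N x∉N' P p'∈
  ...   | p , p∈ , p⇝p' = app M p , ∈-++⁺ʳ _ (∈-map⁺ (app M) p∈) , ⇝-appR p⇝p'

  linᵇ-→oₜ-covers : ∀ {x N N'} → N →oₜ N' → ¬ x ∈FVₜ N → ¬ x ∈FVₜ N' →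
                    ∀ P → Covers (x ⊢_⇝ᵇ_) (linᵇ P x N) (linᵇ P x N')
  linᵇ-→oₜ-covers N→N' x∉N x∉N' [] ()
  linᵇ-→oₜ-covers {x} {N} {N'} N→N' x∉N x∉N' (lin M ∷ P) q'∈
    with ∈-map-++-map⁻ (λ m → lin m ∷ P) (lin M ∷_) (linₜ M x N') (linᵇ P x N') q'∈
  ... | inj₁ (m' , m'∈ , refl) with linₜ-→oₜ-covers N→N' x∉N x∉N' M m'∈
  ...   | m , m∈ , m⇝m' = lin m ∷ P , ∈-++⁺ˡ (∈-map⁺ (λ m → lin m ∷ P) m∈) , ⇝-here m⇝m'
  linᵇ-→oₜ-covers {x} {N} {N'} N→N' x∉N x∉N' (lin M ∷ P) q'∈ | inj₂ (p' , p'∈ , refl)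
    with linᵇ-→oₜ-covers N→N' x∉N x∉N' P p'∈
  ...   | p , p∈ , p⇝p' = lin M ∷ p , ∈-++⁺ʳ _ (∈-map⁺ (lin M ∷_) p∈) , ⇝-there p⇝p'
  linᵇ-→oₜ-covers {x} {N} {N'} N→N' x∉N x∉N' (bang M ∷ P) q'∈
    with ∈-map-++-map⁻ (λ m → lin m ∷ bang M ∷ P) (bang M ∷_) (linₜ M x N') (linᵇ P x N') q'∈
  ... | inj₁ (m' , m'∈ , refl) with linₜ-→oₜ-covers N→N' x∉N x∉N' M m'∈
  ...   | m , m∈ , m⇝m' = lin m ∷ bang M ∷ P , ∈-++⁺ˡ (∈-map⁺ (λ m → lin m ∷ bang M ∷ P) m∈) , ⇝-here m⇝m'
  linᵇ-→oₜ-covers {x} {N} {N'} N→N' x∉N x∉N' (bang M ∷ P) q'∈ | inj₂ (p' , p'∈ , refl)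
    with linᵇ-→oₜ-covers N→N' x∉N x∉N' P p'∈
  ...   | p , p∈ , p⇝p' = bang M ∷ p , ∈-++⁺ʳ _ (∈-map⁺ (bang M ∷_) p∈) , ⇝-there p⇝p'

mutual
  linₜ-⇝-covers : ∀ {x T T'} → x ⊢ T ⇝ₜ T' → ∀ N → Covers (x ⊢_⇝ₜ_) (linₜ T x N) (linₜ T' x N)
  linₜ-⇝-covers (⇝-hole {S' = S'} _ x∉S' _) N U'∈ =
    contradiction (subst (_ ∈_) (linₜ-fresh S' N x∉S') U'∈) λ ()
  linₜ-⇝-covers (⇝-lam M⇝M') N U'∈ with ∈-map⁻ lam U'∈
  ... | u' , u'∈ , refl with linₜ-⇝-covers M⇝M' (shiftₜ 0 N) u'∈
  ...   | u , u∈ , u⇝u' = lam u , ∈-map⁺ lam u∈ , ⇝-lam u⇝u'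
  linₜ-⇝-covers {x} (⇝-appL {M = M} {M'} {P} M⇝M') N U'∈
    with ∈-map-++-map⁻ (λ m → app m P) (app M') (linₜ M' x N) (linᵇ P x N) U'∈
  ... | inj₁ (u' , u'∈ , refl) with linₜ-⇝-covers M⇝M' N u'∈
  ...   | u , u∈ , u⇝u' = app u P , ∈-++⁺ˡ (∈-map⁺ (λ m → app m P) u∈) , ⇝-appL u⇝u'
  linₜ-⇝-covers {x} (⇝-appL {M = M} {M'} {P} M⇝M') N U'∈ | inj₂ (p , p∈ , refl) =
    app M p , ∈-++⁺ʳ _ (∈-map⁺ (app M) p∈) , ⇝-appL M⇝M'
  linₜ-⇝-covers {x} (⇝-appR {M = M} {P} {P'} P⇝P') N U'∈
    with ∈-map-++-map⁻ (λ m → app m P') (app M) (linₜ M x N) (linᵇ P' x N) U'∈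
  ... | inj₁ (u , u∈ , refl) = app u P , ∈-++⁺ˡ (∈-map⁺ (λ m → app m P) u∈) , ⇝-appR P⇝P'
  ... | inj₂ (p' , p'∈ , refl) with linᵇ-⇝-covers P⇝P' N p'∈
  ...   | p , p∈ , p⇝p' = app M p , ∈-++⁺ʳ _ (∈-map⁺ (app M) p∈) , ⇝-appR p⇝p'

  linᵇ-⇝-covers : ∀ {x P P'} → x ⊢ P ⇝ᵇ P' → ∀ N → Covers (x ⊢_⇝ᵇ_) (linᵇ P x N) (linᵇ P' x N)
  linᵇ-⇝-covers {x} (⇝-here {M = M} {M'} {P} M⇝M') N q'∈
    with ∈-map-++-map⁻ (λ m → lin m ∷ P) (lin M' ∷_) (linₜ M' x N) (linᵇ P x N) q'∈
  ... | inj₁ (u' , u'∈ , refl) with linₜ-⇝-covers M⇝M' N u'∈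
  ...   | u , u∈ , u⇝u' = lin u ∷ P , ∈-++⁺ˡ (∈-map⁺ (λ m → lin m ∷ P) u∈) , ⇝-here u⇝u'
  linᵇ-⇝-covers {x} (⇝-here {M = M} {M'} {P} M⇝M') N q'∈ | inj₂ (p , p∈ , refl) =
    lin M ∷ p , ∈-++⁺ʳ _ (∈-map⁺ (lin M ∷_) p∈) , ⇝-here M⇝M'
  linᵇ-⇝-covers {x} (⇝-there {r = lin R} {P} {P'} P⇝P') N q'∈
    with ∈-map-++-map⁻ (λ m → lin m ∷ P') (lin R ∷_) (linₜ R x N) (linᵇ P' x N) q'∈
  ... | inj₁ (u , u∈ , refl) = lin u ∷ P , ∈-++⁺ˡ (∈-map⁺ (λ m → lin m ∷ P) u∈) , ⇝-there P⇝P'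
  ... | inj₂ (p' , p'∈ , refl) with linᵇ-⇝-covers P⇝P' N p'∈
  ...   | p , p∈ , p⇝p' = lin R ∷ p , ∈-++⁺ʳ _ (∈-map⁺ (lin R ∷_) p∈) , ⇝-there p⇝p'
  linᵇ-⇝-covers {x} (⇝-there {r = bang R} {P} {P'} P⇝P') N q'∈
    with ∈-map-++-map⁻ (λ m → lin m ∷ bang R ∷ P') (bang R ∷_) (linₜ R x N) (linᵇ P' x N) q'∈
  ... | inj₁ (u , u∈ , refl) =
    lin u ∷ bang R ∷ P , ∈-++⁺ˡ (∈-map⁺ (λ m → lin m ∷ bang R ∷ P) u∈) , ⇝-there (⇝-there P⇝P')
  ... | inj₂ (p' , p'∈ , refl) with linᵇ-⇝-covers P⇝P' N p'∈
  ...   | p , p∈ , p⇝p' = bang R ∷ p , ∈-++⁺ʳ _ (∈-map⁺ (bang R ∷_) p∈) , ⇝-there p⇝p'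

⇝ᵇ-++ˡ : ∀ {x} P₀ {P P'} → x ⊢ P ⇝ᵇ P' → x ⊢ P₀ ++ P ⇝ᵇ P₀ ++ P'
⇝ᵇ-++ˡ []       P⇝P' = P⇝P'
⇝ᵇ-++ˡ (r ∷ P₀) P⇝P' = ⇝-there (⇝ᵇ-++ˡ P₀ P⇝P')

mutual
  substₜ-⇝-covers : ∀ {x T T'} → x ⊢ T ⇝ₜ T' → ∀ S → Covers (x ⊢_⇝ₜ_) (substₜ T x S) (substₜ T' x S)
  substₜ-⇝-covers (⇝-hole {S = S₀} {S'} x∉S₀ x∉S' S₀→S') S U'∈
    with subst (_ ∈_) (substₜ-fresh S' S x∉S') U'∈
  ... | here refl = S₀ , subst (S₀ ∈_) (sym (substₜ-fresh S₀ S x∉S₀)) (here refl) , ⇝-hole x∉S₀ x∉S' S₀→S'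
  substₜ-⇝-covers (⇝-lam M⇝M') S U'∈ with ∈-map⁻ lam U'∈
  ... | u' , u'∈ , refl with substₜ-⇝-covers M⇝M' (map (shiftₜ 0) S) u'∈
  ...   | u , u∈ , u⇝u' = lam u , ∈-map⁺ lam u∈ , ⇝-lam u⇝u'
  substₜ-⇝-covers {x} (⇝-appL {M' = M'} {P} M⇝M') S U'∈
    with ∈-concatMap-map⁻ app (substₜ M' x S) (substᵇ P x S) U'∈
  ... | u' , p , u'∈ , p∈ , refl with substₜ-⇝-covers M⇝M' S u'∈
  ...   | u , u∈ , u⇝u' = app u p , ∈-concatMap-map⁺ app u∈ p∈ , ⇝-appL u⇝u'
  substₜ-⇝-covers {x} (⇝-appR {M = M} {P' = P'} P⇝P') S U'∈
    with ∈-concatMap-map⁻ app (substₜ M x S) (substᵇ P' x S) U'∈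
  ... | u , p' , u∈ , p'∈ , refl with substᵇ-⇝-covers P⇝P' S p'∈
  ...   | p , p∈ , p⇝p' = app u p , ∈-concatMap-map⁺ app u∈ p∈ , ⇝-appR p⇝p'

  substᵇ-⇝-covers : ∀ {x P P'} → x ⊢ P ⇝ᵇ P' → ∀ S → Covers (x ⊢_⇝ᵇ_) (substᵇ P x S) (substᵇ P' x S)
  substᵇ-⇝-covers {x} (⇝-here {M' = M'} {P} M⇝M') S q'∈
    with ∈-concatMap-map⁻ (λ m p → lin m ∷ p) (substₜ M' x S) (substᵇ P x S) q'∈
  ... | u' , p , u'∈ , p∈ , refl with substₜ-⇝-covers M⇝M' S u'∈
  ...   | u , u∈ , u⇝u' = lin u ∷ p , ∈-concatMap-map⁺ (λ m p → lin m ∷ p) u∈ p∈ , ⇝-here u⇝u'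
  substᵇ-⇝-covers {x} (⇝-there {r = lin R} {P' = P'} P⇝P') S q'∈
    with ∈-concatMap-map⁻ (λ m p → lin m ∷ p) (substₜ R x S) (substᵇ P' x S) q'∈
  ... | u , p' , u∈ , p'∈ , refl with substᵇ-⇝-covers P⇝P' S p'∈
  ...   | p , p∈ , p⇝p' = lin u ∷ p , ∈-concatMap-map⁺ (λ m p → lin m ∷ p) u∈ p∈ , ⇝-there p⇝p'
  substᵇ-⇝-covers {x} (⇝-there {r = bang R} P⇝P') S q'∈ with ∈-map⁻ (map bang (substₜ R x S) ++_) q'∈
  ... | p' , p'∈ , refl with substᵇ-⇝-covers P⇝P' S p'∈
  ...   | p , p∈ , p⇝p' = let bangs = map bang (substₜ R x S) in
    bangs ++ p , ∈-map⁺ (bangs ++_) p∈ , ⇝ᵇ-++ˡ bangs p⇝p'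

resSubst-⇝-covers : ∀ {x 𝔸 𝔸'} → Covers (x ⊢_⇝ₜ_) 𝔸 𝔸' →
                    ∀ R → Covers (x ⊢_⇝ₜ_) (resSubst 𝔸 x R) (resSubst 𝔸' x R)
resSubst-⇝-covers {x} covers (lin N) =
  Covers-concatMap (λ L → linₜ L x N) (λ L → linₜ L x N) (λ T⇝T' → linₜ-⇝-covers T⇝T' N) covers
resSubst-⇝-covers {x} covers (bang N) =
  Covers-concatMap (λ L → substₜ L x (N ∷ var x ∷ [])) (λ L → substₜ L x (N ∷ var x ∷ []))
                   (λ T⇝T' → substₜ-⇝-covers T⇝T' (N ∷ var x ∷ [])) covers

bagSubst-⇝-covers : ∀ {x 𝔸 𝔸'} → Covers (x ⊢_⇝ₜ_) 𝔸 𝔸' →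
                    ∀ Q → Covers (x ⊢_⇝ₜ_) (bagSubst 𝔸 x Q) (bagSubst 𝔸' x Q)
bagSubst-⇝-covers covers []      = covers
bagSubst-⇝-covers covers (R ∷ Q) = bagSubst-⇝-covers (resSubst-⇝-covers covers R) Q

zeroSubst-⇝-covers : ∀ {x 𝔸 𝔸'} → Covers (x ⊢_⇝ₜ_) 𝔸 𝔸' → Covers (x ⊢_⇝ₜ_) (zeroSubst 𝔸 x) (zeroSubst 𝔸' x)
zeroSubst-⇝-covers {x} =
  Covers-concatMap (λ L → substₜ L x []) (λ L → substₜ L x []) (λ T⇝T' → substₜ-⇝-covers T⇝T' [])

resSubst-→oₜ-covers : ∀ {x N N'} → N →oₜ N' → ¬ x ∈FVₜ N → ¬ x ∈FVₜ N' →
                      ∀ 𝔸 → Covers (x ⊢_⇝ₜ_) (resSubst 𝔸 x (lin N)) (resSubst 𝔸 x (lin N'))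
resSubst-→oₜ-covers {x} {N} {N'} N→N' x∉N x∉N' 𝔸 =
  Covers-concatMap (λ L → linₜ L x N) (λ L → linₜ L x N')
                   (λ { {L} refl → linₜ-→oₜ-covers N→N' x∉N x∉N' L }) (Covers-refl 𝔸)

bagSubst-→oᵇ-covers : ∀ {x Q Q'} → Q →oᵇ Q' → ¬ x ∈FVᵇ Q → ¬ x ∈FVᵇ Q' →
                      ∀ 𝔸 → Covers (x ⊢_⇝ₜ_) (bagSubst 𝔸 x Q) (bagSubst 𝔸 x Q')
bagSubst-→oᵇ-covers (o-here {P = P} M→M') x∉Q x∉Q' 𝔸 =
  bagSubst-⇝-covers (resSubst-→oₜ-covers M→M' (x∉Q ∘ fv-lin) (x∉Q' ∘ fv-lin) 𝔸) P
bagSubst-→oᵇ-covers {x} (o-there {r = R} P→P') x∉Q x∉Q' 𝔸 =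
  bagSubst-→oᵇ-covers P→P' (x∉Q ∘ fv-there) (x∉Q' ∘ fv-there) (resSubst 𝔸 x R)

mutual
  ≈ₜ-refl : ∀ T → T ≈ₜ T
  ≈ₜ-refl (var y)   = ≈-var
  ≈ₜ-refl (lam M)   = ≈-lam (≈ₜ-refl M)
  ≈ₜ-refl (app M P) = ≈-app (≈ₜ-refl M) (≈ᵇ-refl P)

  ≈ᵇ-refl : ∀ P → P ≈ᵇ P
  ≈ᵇ-refl []           = ≈-nil
  ≈ᵇ-refl (lin M ∷ P)  = ≈-cons (≈-lin (≈ₜ-refl M)) (≈ᵇ-refl P)
  ≈ᵇ-refl (bang M ∷ P) = ≈-cons (≈-bang (≈ₜ-refl M)) (≈ᵇ-refl P)

lemma3p8 : (O : Term) (Q Q' : Bag) (x : ℕ) →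
    ¬ (x ∈FVᵇ Q) → ¬ (x ∈FVᵇ Q') → Q →oᵇ Q' →
    (L' : Term) → L' ∈ bagSubst0 O x Q' →
    Σ Term (λ L → L ∈ bagSubst0 O x Q ×
      Σ Term (λ L'' → (L →oₜ L'') × (L'' ≈ₜ L')))
lemma3p8 O Q Q' x x∉Q x∉Q' Q→Q' L' L'∈
  with zeroSubst-⇝-covers (bagSubst-→oᵇ-covers Q→Q' x∉Q x∉Q' (O ∷ [])) L'∈
... | L , L∈ , L⇝L' = L , L∈ , L' , ⇝ₜ⇒→oₜ L⇝L' , ≈ₜ-refl L'
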